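{- For every two finite simple graphs $G$ and $H$ without vertices of degree 0, $$\gamma_{tR}(G\times H)\le \min\{\omega(g)\omega(h)-2|A_2||B_2|\},$$ where the minimum is taken over all total Roman dominating functions $g=(A_0,A_1,A_2)$ on $G$ and $h=(B_0,B_1,B_2)$ on $H$.
   Context: For a graph $G$, a function $f:V(G)\to\{0,1,2\}$ is written $f=(V_0,V_1,V_2)$ with $V_i=f^{ -1}(i)$; its weight is $\omega(f)=\sum_v f(v)$. It is a total Roman dominating function if every vertex in $V_0$ has a neighbor in $V_2$ and the subgraph induced by $V_1\cup V_2$ has no isolated vertices. $\gamma_{tR}(G)$ is the minimum weight of a total Roman dominating function on $G$. The direct product $G\times H$ has vertex set $V(G)\times V(H)$, with $(g,h)(g',h')$ an edge iff $gg'\in E(G)$ and $hh'\in E(H)$. -}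

module Defs where

open import Data.Nat using (ℕ; _+_; _*_)
open import Data.Fin using (Fin)
open import Data.List using (List; map; allFin; concatMap)
open import Data.Nat.ListAction using (sum)
open import Data.Product using (_×_; _,_; Σ; ∃; ∃-syntax)
open import Data.Empty using (⊥)
open import Relation.Nullary using (¬_)
open import Relation.Binary.PropositionalEquality using (_≡_)

data Label : Set where
  l0 l1 l2 : Label

val : Label → ℕ
val l0 = 0
val l1 = 1
val l2 = 2

record Graph (n : ℕ) : Set₁ where
  field
    Adj   : Fin n → Fin n → Set
    sym   : ∀ {u v} → Adj u v → Adj v u
    irrefl : ∀ {v} → ¬ Adj v v

open Graph public

NoIsolated : ∀ {n} → Graph n → Set
NoIsolated {n} G = (v : Fin n) → ∃[ u ] Adj G v u

IsTRDF : {V : Set} → (V → V → Set) → (V → Label) → Set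
IsTRDF {V} A f =
  ((v : V) → f v ≡ l0 → ∃[ u ] (A v u × f u ≡ l2))
  × ((v : V) → ¬ (f v ≡ l0) → ∃[ u ] (A v u × ¬ (f u ≡ l0)))

DirAdj : ∀ {n m} → Graph n → Graph m → (Fin n × Fin m) → (Fin n × Fin m) → Set
DirAdj G H (g , h) (g' , h') = Adj G g g' × Adj H h h'

weight : ∀ {n} → (Fin n → Label) → ℕ
weight {n} f = sum (map (λ v → val (f v)) (allFin n))

weight² : ∀ {n m} → (Fin n × Fin m → Label) → ℕ
weight² {n} {m} f = sum (concatMap (λ g → map (λ h → val (f (g , h))) (allFin m)) (allFin n))

ind2 : Label → ℕ
ind2 l2 = 1
ind2 _  = 0

count2 : ∀ {n} → (Fin n → Label) → ℕ
count2 {n} f = sum (map (λ v → ind2 (f v)) (allFin n))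

module Submission where

-- Given total Roman dominating
-- functions g on G and h on H, label the vertex (a , b) of G × H by the
-- "product label" g a ⊗ h b: it is 0 when either factor is 0, 1 when both
-- are 1, and 2 otherwise.
--
-- For single labels, val (x ⊗ y) + 2·[x = 2]·[y = 2] = val x · val y.
--  * Domination.  In a total Roman dominating function every vertex has a
--    neighbour with a positive label; pairing such neighbours (or a neighbour
--    labelled 2 in the factor where the label is 0) shows that the product
--    labelling is total Roman dominating for the direct product of any two
--    adjacency relations, with no graph structure needed.
--  * Weight.  Summing the label identity over all pairs (a , b), using that
--    finite sums distribute over products, gives
--    weight (g ⊗ h) + 2·|A₂|·|B₂| = weight g · weight h.

open import Defs hiding (sym)
open import Data.Nat using (ℕ; _+_; _*_; _≤_)
open import Data.Nat.Properties using (+-assoc; +-comm; *-comm; *-zeroʳ; *-distribˡ-+; ≤-reflexive)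
open import Data.Nat.ListAction using (sum)
open import Data.Nat.ListAction.Properties using (sum-++)
open import Data.Fin using (Fin)
open import Data.List using (List; []; _∷_; map; allFin; concatMap)
open import Data.List.Properties using (map-cong)
open import Data.Product using (_×_; ∃-syntax; _,_)
open import Data.Product.Relation.Binary.Pointwise.NonDependent using (Pointwise)
open import Data.Sum using (_⊎_; inj₁; inj₂)
open import Relation.Nullary using (Dec; yes; no)
open import Relation.Binary.PropositionalEquality
  using (_≡_; _≢_; refl; sym; trans; cong; cong₂; module ≡-Reasoning)

Σ : {A : Set} → List A → (A → ℕ) → ℕ
Σ xs f = sum (map f xs)

Σ-cong : {A : Set} (xs : List A) {f k : A → ℕ} → (∀ a → f a ≡ k a) → Σ xs f ≡ Σ xs k
Σ-cong xs f≗k = cong sum (map-cong f≗k xs)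

Σ-+ : {A : Set} (xs : List A) (f k : A → ℕ) → Σ xs f + Σ xs k ≡ Σ xs (λ a → f a + k a)
Σ-+ [] f k = refl
Σ-+ (x ∷ xs) f k = begin
    (f x + Σ xs f) + (k x + Σ xs k)  ≡⟨ +-assoc (f x) _ _ ⟩
    f x + (Σ xs f + (k x + Σ xs k))  ≡⟨ cong (f x +_) (swap-middle (Σ xs f) (k x) (Σ xs k)) ⟩
    f x + (k x + (Σ xs f + Σ xs k))  ≡⟨ sym (+-assoc (f x) _ _) ⟩
    (f x + k x) + (Σ xs f + Σ xs k)  ≡⟨ cong ((f x + k x) +_) (Σ-+ xs f k) ⟩
    (f x + k x) + Σ xs (λ a → f a + k a) ∎
  where
  open ≡-Reasoning
  swap-middle : ∀ p q r → p + (q + r) ≡ q + (p + r)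
  swap-middle p q r = trans (sym (+-assoc p q r)) (trans (cong (_+ r) (+-comm p q)) (+-assoc q p r))

Σ-*ˡ : {A : Set} (c : ℕ) (xs : List A) (f : A → ℕ) → c * Σ xs f ≡ Σ xs (λ a → c * f a)
Σ-*ˡ c [] f = *-zeroʳ c
Σ-*ˡ c (x ∷ xs) f = trans (*-distribˡ-+ c (f x) _) (cong (c * f x +_) (Σ-*ˡ c xs f))

Σ-product : {A B : Set} (xs : List A) (ys : List B) (f : A → ℕ) (k : B → ℕ) →
  Σ xs f * Σ ys k ≡ Σ xs (λ a → Σ ys (λ b → f a * k b))
Σ-product xs ys f k = begin
    Σ xs f * Σ ys k                       ≡⟨ *-comm (Σ xs f) _ ⟩
    Σ ys k * Σ xs f                       ≡⟨ Σ-*ˡ (Σ ys k) xs f ⟩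
    Σ xs (λ a → Σ ys k * f a)             ≡⟨ Σ-cong xs (λ a → *-comm (Σ ys k) (f a)) ⟩
    Σ xs (λ a → f a * Σ ys k)             ≡⟨ Σ-cong xs (λ a → Σ-*ˡ (f a) ys k) ⟩
    Σ xs (λ a → Σ ys (λ b → f a * k b))   ∎
  where open ≡-Reasoning

Σ-concatMap : {A B : Set} (xs : List A) (ys : List B) (k : A → B → ℕ) →
  sum (concatMap (λ a → map (k a) ys) xs) ≡ Σ xs (λ a → Σ ys (k a))
Σ-concatMap [] ys k = refl
Σ-concatMap (x ∷ xs) ys k =
  trans (sum-++ (map (k x) ys) _) (cong (Σ ys (k x) +_) (Σ-concatMap xs ys k))

_⊗_ : Label → Label → Label
l0 ⊗ _  = l0
l1 ⊗ l0 = l0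
l1 ⊗ l1 = l1
l1 ⊗ l2 = l2
l2 ⊗ l0 = l0
l2 ⊗ l1 = l2
l2 ⊗ l2 = l2

⊗-weight : ∀ x y → val (x ⊗ y) + 2 * (ind2 x * ind2 y) ≡ val x * val y
⊗-weight l0 y  = refl
⊗-weight l1 l0 = refl
⊗-weight l1 l1 = refl
⊗-weight l1 l2 = refl
⊗-weight l2 l0 = refl
⊗-weight l2 l1 = refl
⊗-weight l2 l2 = refl

⊗-zero : ∀ x y → x ⊗ y ≡ l0 → x ≡ l0 ⊎ y ≡ l0
⊗-zero l0 y  _ = inj₁ refl
⊗-zero l1 l0 _ = inj₂ refl
⊗-zero l2 l0 _ = inj₂ refl
⊗-zero l1 l1 ()
⊗-zero l1 l2 ()
⊗-zero l2 l1 ()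
⊗-zero l2 l2 ()

⊗-positive : ∀ {x y} → x ≢ l0 → y ≢ l0 → x ⊗ y ≢ l0
⊗-positive {x} {y} x≢0 y≢0 xy≡0 with ⊗-zero x y xy≡0
... | inj₁ x≡0 = x≢0 x≡0
... | inj₂ y≡0 = y≢0 y≡0

⊗-twoˡ : ∀ {x y} → x ≡ l2 → y ≢ l0 → x ⊗ y ≡ l2
⊗-twoˡ {y = l0} refl y≢0 with () ← y≢0 refl
⊗-twoˡ {y = l1} refl _ = refl
⊗-twoˡ {y = l2} refl _ = refl

⊗-twoʳ : ∀ {x y} → x ≢ l0 → y ≡ l2 → x ⊗ y ≡ l2
⊗-twoʳ {x = l0} x≢0 refl with () ← x≢0 refl
⊗-twoʳ {x = l1} _ refl = refl
⊗-twoʳ {x = l2} _ refl = refl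

_≟l0 : (x : Label) → Dec (x ≡ l0)
l0 ≟l0 = yes refl
l1 ≟l0 = no λ ()
l2 ≟l0 = no λ ()

positive-neighbour : {V : Set} (A : V → V → Set) (f : V → Label) → IsTRDF A f →
  ∀ v → ∃[ u ] (A v u × f u ≢ l0)
positive-neighbour A f (dominated , total) v with f v ≟l0
... | yes fv≡0 =
  let (u , vu , fu≡2) = dominated v fv≡0 in u , vu , λ fu≡0 → l2≢l0 (trans (sym fu≡2) fu≡0)
  where
  l2≢l0 : l2 ≢ l0
  l2≢l0 ()
... | no fv≢0 = total v fv≢0

_⊗ᶠ_ : {V W : Set} → (V → Label) → (W → Label) → V × W → Label
(g ⊗ᶠ h) (a , b) = g a ⊗ h b

⊗-IsTRDF : {V W : Set} (A : V → V → Set) (B : W → W → Set) (g : V → Label) (h : W → Label) →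
  IsTRDF A g → IsTRDF B h → IsTRDF (Pointwise A B) (g ⊗ᶠ h)
⊗-IsTRDF {V} {W} A B g h g-trdf@(g-dominated , _) h-trdf@(h-dominated , _) = dominated , total
  where
  dominated : (v : V × W) → (g ⊗ᶠ h) v ≡ l0 → ∃[ u ] (Pointwise A B v u × (g ⊗ᶠ h) u ≡ l2)
  dominated (a , b) ab≡0 with ⊗-zero (g a) (h b) ab≡0
  ... | inj₁ ga≡0 with g-dominated a ga≡0 | positive-neighbour B h h-trdf b
  ...   | a' , aa' , ga'≡2 | b' , bb' , hb'≢0 = (a' , b') , (aa' , bb') , ⊗-twoˡ ga'≡2 hb'≢0
  dominated (a , b) ab≡0 | inj₂ hb≡0 with positive-neighbour A g g-trdf a | h-dominated b hb≡0
  ...   | a' , aa' , ga'≢0 | b' , bb' , hb'≡2 = (a' , b') , (aa' , bb') , ⊗-twoʳ ga'≢0 hb'≡2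
  total : (v : V × W) → (g ⊗ᶠ h) v ≢ l0 → ∃[ u ] (Pointwise A B v u × (g ⊗ᶠ h) u ≢ l0)
  total (a , b) _ with positive-neighbour A g g-trdf a | positive-neighbour B h h-trdf b
  ... | a' , aa' , ga'≢0 | b' , bb' , hb'≢0 = (a' , b') , (aa' , bb') , ⊗-positive ga'≢0 hb'≢0

⊗-weight² : ∀ {n m} (g : Fin n → Label) (h : Fin m → Label) →
  weight² (g ⊗ᶠ h) + 2 * (count2 g * count2 h) ≡ weight g * weight h
⊗-weight² {n} {m} g h = begin
    weight² (g ⊗ᶠ h) + 2 * (count2 g * count2 h)
  ≡⟨ cong₂ _+_ (Σ-concatMap as bs (λ a b → val (g a ⊗ h b))) twice-count ⟩
    Σ as (λ a → Σ bs (λ b → val (g a ⊗ h b))) + Σ as (λ a → Σ bs (λ b → 2 * (ind2 (g a) * ind2 (h b))))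
  ≡⟨ Σ-+ as _ _ ⟩
    Σ as (λ a → Σ bs (λ b → val (g a ⊗ h b)) + Σ bs (λ b → 2 * (ind2 (g a) * ind2 (h b))))
  ≡⟨ Σ-cong as (λ a → trans (Σ-+ bs _ _) (Σ-cong bs (λ b → ⊗-weight (g a) (h b)))) ⟩
    Σ as (λ a → Σ bs (λ b → val (g a) * val (h b)))
  ≡⟨ sym (Σ-product as bs (λ a → val (g a)) (λ b → val (h b))) ⟩
    weight g * weight h ∎
  where
  open ≡-Reasoning
  as = allFin n
  bs = allFin m
  twice-count : 2 * (count2 g * count2 h) ≡ Σ as (λ a → Σ bs (λ b → 2 * (ind2 (g a) * ind2 (h b))))
  twice-count = begin
      2 * (count2 g * count2 h)
    ≡⟨ cong (2 *_) (Σ-product as bs (λ a → ind2 (g a)) (λ b → ind2 (h b))) ⟩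
      2 * Σ as (λ a → Σ bs (λ b → ind2 (g a) * ind2 (h b)))
    ≡⟨ Σ-*ˡ 2 as _ ⟩
      Σ as (λ a → 2 * Σ bs (λ b → ind2 (g a) * ind2 (h b)))
    ≡⟨ Σ-cong as (λ a → Σ-*ˡ 2 bs _) ⟩
      Σ as (λ a → Σ bs (λ b → 2 * (ind2 (g a) * ind2 (h b)))) ∎

mainTheorem3 : ∀ {n m} (G : Graph n) (H : Graph m) → NoIsolated G → NoIsolated H →
    (g : Fin n → Label) → IsTRDF (Adj G) g →
    (h : Fin m → Label) → IsTRDF (Adj H) h →
    ∃[ f ] (IsTRDF (DirAdj G H) f × weight² f + 2 * (count2 g * count2 h) ≤ weight g * weight h)
mainTheorem3 G H _ _ g g-trdf h h-trdf =
  g ⊗ᶠ h ,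
  ⊗-IsTRDF (Adj G) (Adj H) g h g-trdf h-trdf ,
  ≤-reflexive (⊗-weight² g h)
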